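{- For integers $0\le k\le n$, there is a bijection between $\mathcal{CR}(n,k)$ and the set of semistandard Young tableaux of shape $(n,n)$ and type $(1^{2k},2^{n-k})$. In particular $CR(n,k)=K_{(n,n)(1^{2k},2^{n-k})}$.
   Context: For $0\le k\le n$, $\mathcal{CR}(n,k)$ (Catalan-Riordan paths of size $(n,k)$) is the set of lattice paths from $(0,0)$ to $(n+k,0)$ such that (1) the first $2k$ steps lie in $\{(1,1),(1,-1)\}$; (2) the last $n-k$ steps lie in $\{(1,2),(1,0),(1,-2)\}$, and there is no step $(1,0)$ on the $x$-axis; (3) the path never goes below the $x$-axis. $CR(n,k)=|\mathcal{CR}(n,k)|$. The type $(1^{2k},2^{n-k})$ means the entries $1,\ldots,2k$ each occur once and the entries $2k+1,\ldots,n+k$ each occur twice. $K_{\lambda\mu}$ is the number of semistandard Young tableaux of shape $\lambda$ and type $\mu$. -}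

module Defs where

open import Data.Nat using (ℕ; zero; suc; _+_; _*_; _∸_; _≤_; _<_; _<?_)
open import Data.Fin using (Fin; toℕ)
open import Data.Vec using (Vec; []; _∷_; _++_; lookup; count; allFin; tabulate)
open import Data.Vec.Relation.Binary.Pointwise.Inductive using (Pointwise)
open import Data.Product using (Σ; _×_)
open import Data.Unit using (⊤)
open import Data.Empty using (⊥)
open import Relation.Binary.PropositionalEquality using (_≡_)
open import Relation.Nullary.Decidable using (Dec; yes; no)
import Data.Nat.Properties as ℕₚ
open import Data.Fin.Properties using (_≟_)

-- First-phase steps (1,1) and (1,-1)
data Step₁ : Set where
  up down : Step₁

-- Second-phase steps (1,2), (1,0), (1,-2)
data Step₂ : Set where
  up2 flat down2 : Step₂

Valid₂ : ℕ → {m : ℕ} → Vec Step₂ m → Set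
Valid₂ h [] = h ≡ 0
Valid₂ h (up2 ∷ s) = Valid₂ (suc (suc h)) s
Valid₂ zero (flat ∷ s) = ⊥
Valid₂ (suc h) (flat ∷ s) = Valid₂ (suc h) s
Valid₂ zero (down2 ∷ s) = ⊥
Valid₂ (suc zero) (down2 ∷ s) = ⊥
Valid₂ (suc (suc h)) (down2 ∷ s) = Valid₂ h s

Valid : ℕ → {m p : ℕ} → Vec Step₁ m → Vec Step₂ p → Set
Valid h [] t = Valid₂ h t
Valid h (up ∷ s) t = Valid (suc h) s t
Valid zero (down ∷ s) t = ⊥
Valid (suc h) (down ∷ s) t = Valid h s t

record CRPath (n k : ℕ) : Set where
  constructor crpath
  field
    first  : Vec Step₁ (2 * k)
    second : Vec Step₂ (n ∸ k)
    valid  : Valid 0 first second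

WeaklyIncr : {A : Set} → (A → A → Set) → {m : ℕ} → Vec A m → Set
WeaklyIncr _≤'_ [] = ⊤
WeaklyIncr _≤'_ (x ∷ []) = ⊤
WeaklyIncr _≤'_ (x ∷ y ∷ s) = (x ≤' y) × WeaklyIncr _≤'_ (y ∷ s)

_≤F_ : {m : ℕ} → Fin m → Fin m → Set
i ≤F j = toℕ i ≤ toℕ j

_<F_ : {m : ℕ} → Fin m → Fin m → Set
i <F j = toℕ i < toℕ j

-- Type (1^{2k}, 2^{n-k}) as a content vector indexed by the n+k labels
-- (label (i : Fin (n+k)) stands for the entry i+1):
-- labels 1..2k occur once, labels 2k+1..n+k occur twice.
typeμ : (n k : ℕ) → Fin (n + k) → ℕ
typeμ n k i with toℕ i <? 2 * k
... | yes _ = 1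
... | no _ = 2

occurrences : {m r : ℕ} → Fin m → Vec (Fin m) r → ℕ
occurrences i v = Data.Vec.count (λ x → x ≟ i) v

-- Column strictness and content are stated via the inductive Pointwise
-- relation (first-order data, so equality of tableaux needs no funext):
-- cols: row₁[j] < row₂[j] for all j; content: label i occurs typeμ n k i times.
record SSYT (n k : ℕ) : Set where
  constructor ssyt
  field
    row₁ : Vec (Fin (n + k)) n
    row₂ : Vec (Fin (n + k)) n
    rows₁ : WeaklyIncr _≤F_ row₁
    rows₂ : WeaklyIncr _≤F_ row₂
    cols  : Pointwise _<F_ row₁ row₂
    content : Pointwise (λ i c → occurrences i (row₁ ++ row₂) ≡ c)
                (allFin (n + k)) (tabulate (typeμ n k))

-- A semistandard tableau of shape (n,n) with sorted rows is determined by its content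
-- sequence: for each letter w, the numbers a_w and b_w of copies of w in the first and in the
-- second row. For the type (1^{2k},2^{n-k}) we have a_w + b_w = 1 for the first 2k letters and
-- a_w + b_w = 2 for the others, and the possible pairs (a_w , b_w) are exactly the numbers of
-- up and down units of the steps (1,±1), resp. (1,2), (1,0), (1,-2). Deleting all letters
-- below w leaves a two-row skew tableau whose first row is indented by h = Σ_{v<w} (a_v - b_v)
-- columns, the height of the path before step w; deleting the letter w as well keeps the
-- columns strict exactly when b_w ≤ h. Reading step w as b_w down units followed by a_w up
-- units, this says that the path stays above the x-axis and makes no (1,0) step on it.

module Submission where

open import Defs
open import Data.Nat using (ℕ; _≤_)
open import Function.Bundles using (_⤖_)

open import Algebra.Properties.CommutativeSemigroup using (interchange)
open import Data.Bool using (T; true; false; if_then_else_)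
open import Data.Empty using (⊥-elim)
open import Data.Fin as Fin using (Fin; toℕ; fromℕ<)
open import Data.Fin.Properties using (toℕ<n; toℕ-injective; toℕ-fromℕ<) renaming (_≟_ to _≟ᶠ_)
open import Data.List using (List; []; _∷_; _++_; length; map; replicate; drop; applyUpTo)
open import Data.List.Properties
  using (length-++; length-map; length-replicate; length-drop; drop-map; drop-drop; ∷-injective)
open import Data.List.Relation.Binary.Pointwise as Pointwise using (Pointwise; []; _∷_; map⁺; map⁻)
open import Data.List.Relation.Unary.All as All using (All; []; _∷_)
import Data.List.Relation.Unary.All.Properties as Allₚ
open import Data.Nat using (zero; suc; _+_; _*_; _∸_; _<_; z≤n; s≤s; s≤s⁻¹; z<s; _≡ᵇ_; _<?_; _≤?_)
open import Data.Nat.ListAction using (sum)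
open import Data.Nat.Properties
open import Data.Product using (_×_; _,_; proj₁; proj₂)
open import Data.Unit using (⊤; tt)
open import Data.Vec as Vec using (Vec; []; _∷_; lookup; tabulate; toList) renaming (_++_ to _++ᵥ_)
open import Data.Vec.Properties
  using (map-++; toList-++; length-toList; lookup∘tabulate; lookup-allFin; tabulate-cong; tabulate∘lookup)
open import Data.Vec.Relation.Binary.Pointwise.Inductive as VecPointwise using ([]; _∷_)
open import Function using (_∘_)
open import Function.Bundles using (mk↔ₛ′)
open import Function.Properties.Inverse using (↔⇒⤖)
open import Relation.Binary.PropositionalEquality
open import Relation.Nullary using (¬_; yes; no)

-- Sorted words and their content

multiplicity : ℕ → List ℕ → ℕ
multiplicity w [] = 0
multiplicity w (x ∷ xs) = if w ≡ᵇ x then suc (multiplicity w xs) else multiplicity w xs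

multiplicity-++ : ∀ w xs ys → multiplicity w (xs ++ ys) ≡ multiplicity w xs + multiplicity w ys
multiplicity-++ w [] ys = refl
multiplicity-++ w (x ∷ xs) ys with w ≡ᵇ x
... | true = cong suc (multiplicity-++ w xs ys)
... | false = multiplicity-++ w xs ys

multiplicity-zero-map-suc : ∀ S → multiplicity 0 (map suc S) ≡ 0
multiplicity-zero-map-suc [] = refl
multiplicity-zero-map-suc (x ∷ S) = multiplicity-zero-map-suc S

multiplicity-suc-map-suc : ∀ w S → multiplicity (suc w) (map suc S) ≡ multiplicity w S
multiplicity-suc-map-suc w [] = refl
multiplicity-suc-map-suc w (x ∷ S) with w ≡ᵇ x
... | true = cong suc (multiplicity-suc-map-suc w S)
... | false = multiplicity-suc-map-suc w S

shift : ℕ → List ℕ → List ℕ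
shift a S = replicate a 0 ++ map suc S

multiplicity-zero-shift : ∀ a S → multiplicity 0 (shift a S) ≡ a
multiplicity-zero-shift zero S = multiplicity-zero-map-suc S
multiplicity-zero-shift (suc a) S = cong suc (multiplicity-zero-shift a S)

multiplicity-suc-shift : ∀ w a S → multiplicity (suc w) (shift a S) ≡ multiplicity w S
multiplicity-suc-shift w zero S = multiplicity-suc-map-suc w S
multiplicity-suc-shift w (suc a) S = multiplicity-suc-shift w a S

length-shift : ∀ a S → length (shift a S) ≡ a + length S
length-shift a S = trans (length-++ (replicate a 0)) (cong₂ _+_ (length-replicate a) (length-map suc S))

sortedWord : (ℕ → ℕ) → ℕ → List ℕ
sortedWord a zero = []
sortedWord a (suc L) = shift (a 0) (sortedWord (a ∘ suc) L)

multiplicity-sortedWord : ∀ a L w → w < L → multiplicity w (sortedWord a L) ≡ a w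
multiplicity-sortedWord a (suc L) zero _ = multiplicity-zero-shift (a 0) _
multiplicity-sortedWord a (suc L) (suc w) (s≤s w<L) =
  trans (multiplicity-suc-shift w (a 0) _) (multiplicity-sortedWord (a ∘ suc) L w w<L)

sortedWord-cong : ∀ a b L → (∀ w → w < L → a w ≡ b w) → sortedWord a L ≡ sortedWord b L
sortedWord-cong a b zero _ = refl
sortedWord-cong a b (suc L) a≡b =
  cong₂ shift (a≡b 0 z<s) (sortedWord-cong (a ∘ suc) (b ∘ suc) L (λ w w<L → a≡b (suc w) (s≤s w<L)))

Sorted : List ℕ → Set
Sorted [] = ⊤
Sorted (x ∷ []) = ⊤
Sorted (x ∷ y ∷ s) = x ≤ y × Sorted (y ∷ s)

sorted-tail : ∀ x xs → Sorted (x ∷ xs) → Sorted xs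
sorted-tail x [] _ = tt
sorted-tail x (y ∷ xs) (_ , s) = s

sorted-map-suc : ∀ S → Sorted S → Sorted (map suc S)
sorted-map-suc [] _ = tt
sorted-map-suc (x ∷ []) _ = tt
sorted-map-suc (x ∷ y ∷ S) (x≤y , s) = s≤s x≤y , sorted-map-suc (y ∷ S) s

sorted-shift : ∀ a S → Sorted S → Sorted (shift a S)
sorted-shift zero S s = sorted-map-suc S s
sorted-shift (suc zero) [] s = tt
sorted-shift (suc zero) (x ∷ S) s = z≤n , sorted-map-suc (x ∷ S) s
sorted-shift (suc (suc a)) S s = z≤n , sorted-shift (suc a) S s

sorted-sortedWord : ∀ a L → Sorted (sortedWord a L)
sorted-sortedWord a zero = tt
sorted-sortedWord a (suc L) = sorted-shift (a 0) _ (sorted-sortedWord (a ∘ suc) L)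

all-shift : ∀ {L} a S → All (_< L) S → All (_< suc L) (shift a S)
all-shift zero S S<L = Allₚ.map⁺ (All.map s≤s S<L)
all-shift (suc a) S S<L = z<s ∷ all-shift a S S<L

all-sortedWord : ∀ a L → All (_< L) (sortedWord a L)
all-sortedWord a zero = []
all-sortedWord a (suc L) = all-shift (a 0) _ (all-sortedWord (a ∘ suc) L)

unshift : List ℕ → List ℕ
unshift [] = []
unshift (zero ∷ xs) = unshift xs
unshift (suc x ∷ xs) = x ∷ unshift xs

multiplicity-suc-unshift : ∀ w R → multiplicity (suc w) R ≡ multiplicity w (unshift R)
multiplicity-suc-unshift w [] = refl
multiplicity-suc-unshift w (zero ∷ xs) = multiplicity-suc-unshift w xs
multiplicity-suc-unshift w (suc x ∷ xs) with w ≡ᵇ x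
... | true = cong suc (multiplicity-suc-unshift w xs)
... | false = multiplicity-suc-unshift w xs

sorted-unshift : ∀ R → Sorted R → Sorted (unshift R)
sorted-unshift [] _ = tt
sorted-unshift (zero ∷ xs) s = sorted-unshift xs (sorted-tail 0 xs s)
sorted-unshift (suc x ∷ []) _ = tt
sorted-unshift (suc x ∷ suc y ∷ xs) (s≤s x≤y , s) = x≤y , sorted-unshift (suc y ∷ xs) s

all-unshift : ∀ {L} R → All (_< suc L) R → All (_< L) (unshift R)
all-unshift [] [] = []
all-unshift (zero ∷ xs) (_ ∷ xs<L) = all-unshift xs xs<L
all-unshift (suc x ∷ xs) (s≤s x<L ∷ xs<L) = x<L ∷ all-unshift xs xs<L

shift-unshift-positive : ∀ x xs → Sorted (suc x ∷ xs) →
                         shift 0 (unshift xs) ≡ xs × multiplicity 0 xs ≡ 0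
shift-unshift-positive x [] _ = refl , refl
shift-unshift-positive x (suc y ∷ xs) (_ , s) with shift-unshift-positive y xs s
... | xs≡ , m≡0 = cong (suc y ∷_) xs≡ , m≡0

shift-unshift : ∀ R → Sorted R → shift (multiplicity 0 R) (unshift R) ≡ R
shift-unshift [] _ = refl
shift-unshift (zero ∷ xs) s = cong (0 ∷_) (shift-unshift xs (sorted-tail 0 xs s))
shift-unshift (suc x ∷ xs) s with shift-unshift-positive x xs s
... | xs≡ , m≡0 rewrite m≡0 = cong (suc x ∷_) xs≡

sortedWord-multiplicity : ∀ L R → Sorted R → All (_< L) R → sortedWord (λ w → multiplicity w R) L ≡ R
sortedWord-multiplicity zero [] _ _ = refl
sortedWord-multiplicity zero (x ∷ R) _ (() ∷ _)
sortedWord-multiplicity (suc L) R s R<L = begin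
  shift (multiplicity 0 R) (sortedWord (λ w → multiplicity (suc w) R) L)
    ≡⟨ cong (shift (multiplicity 0 R)) (sortedWord-cong _ _ L (λ w _ → multiplicity-suc-unshift w R)) ⟩
  shift (multiplicity 0 R) (sortedWord (λ w → multiplicity w (unshift R)) L)
    ≡⟨ cong (shift (multiplicity 0 R))
            (sortedWord-multiplicity L (unshift R) (sorted-unshift R s) (all-unshift R R<L)) ⟩
  shift (multiplicity 0 R) (unshift R)
    ≡⟨ shift-unshift R s ⟩
  R ∎
  where open ≡-Reasoning

sortedWord-content : ∀ a L R → Sorted R → All (_< L) R →
                     (∀ w → w < L → a w ≡ multiplicity w R) → sortedWord a L ≡ R
sortedWord-content a L R s R<L a≡ = trans (sortedWord-cong _ _ L a≡) (sortedWord-multiplicity L R s R<L)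

-- Two-row skew tableaux and admissible walks

-- The rows R₁ over R₂ of a two-row skew tableau in which R₁ is indented h columns
-- further than R₂, with strictly increasing columns.
Skew : ℕ → List ℕ → List ℕ → Set
Skew h R₁ R₂ = Pointwise _<_ R₁ (drop h R₂) × length R₂ ≡ h + length R₁

drop-shift : ∀ b d S → drop (b + d) (shift b S) ≡ map suc (drop d S)
drop-shift zero d S = drop-map d S
drop-shift (suc b) d S = drop-shift b d S

drop-shift-overhang : ∀ h o S → drop h (shift (suc h + o) S) ≡ 0 ∷ shift o S
drop-shift-overhang zero o S = refl
drop-shift-overhang (suc h) o S = drop-shift-overhang h o S

pointwise-shift⁺ : ∀ a S U → Pointwise _<_ S (drop a U) → a + length S ≡ length U →
                   Pointwise _<_ (shift a S) (map suc U)
pointwise-shift⁺ zero S U S<U _ = map⁺ suc suc (Pointwise.map s≤s S<U)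
pointwise-shift⁺ (suc a) S (u ∷ U) S<U |S|≡|U| =
  z<s ∷ pointwise-shift⁺ a S U S<U (suc-injective |S|≡|U|)

pointwise-shift⁻ : ∀ a S U → Pointwise _<_ (shift a S) (map suc U) → Pointwise _<_ S (drop a U)
pointwise-shift⁻ zero S U S<U = Pointwise.map s≤s⁻¹ (map⁻ suc suc S<U)
pointwise-shift⁻ (suc a) S (u ∷ U) (_ ∷ S<U) = pointwise-shift⁻ a S U S<U

skew-shift⁺ : ∀ a b d S₁ S₂ → Skew (d + a) S₁ S₂ → Skew (b + d) (shift a S₁) (shift b S₂)
skew-shift⁺ a b d S₁ S₂ (S₁<S₂ , |S₂|≡) = columns , lengths
  where
  open ≡-Reasoning
  |drop-d-S₂| : a + length S₁ ≡ length (drop d S₂)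
  |drop-d-S₂| = sym (begin
    length (drop d S₂)      ≡⟨ length-drop d S₂ ⟩
    length S₂ ∸ d           ≡⟨ cong (_∸ d) (trans |S₂|≡ (+-assoc d a (length S₁))) ⟩
    d + (a + length S₁) ∸ d ≡⟨ m+n∸m≡n d (a + length S₁) ⟩
    a + length S₁           ∎)
  columns : Pointwise _<_ (shift a S₁) (drop (b + d) (shift b S₂))
  columns = subst (Pointwise _<_ (shift a S₁)) (sym (drop-shift b d S₂))
    (pointwise-shift⁺ a S₁ (drop d S₂)
      (subst (Pointwise _<_ S₁) (sym (drop-drop d a S₂)) S₁<S₂) |drop-d-S₂|)
  lengths : length (shift b S₂) ≡ b + d + length (shift a S₁)
  lengths = begin
    length (shift b S₂)      ≡⟨ length-shift b S₂ ⟩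
    b + length S₂            ≡⟨ cong (b +_) (trans |S₂|≡ (+-assoc d a (length S₁))) ⟩
    b + (d + (a + length S₁)) ≡⟨ sym (+-assoc b d _) ⟩
    b + d + (a + length S₁)  ≡⟨ cong (b + d +_) (sym (length-shift a S₁)) ⟩
    b + d + length (shift a S₁) ∎

skew-shift⁻ : ∀ a b d S₁ S₂ → Skew (b + d) (shift a S₁) (shift b S₂) → Skew (d + a) S₁ S₂
skew-shift⁻ a b d S₁ S₂ (columns , lengths) = S₁<S₂ , |S₂|≡
  where
  open ≡-Reasoning
  S₁<S₂ : Pointwise _<_ S₁ (drop (d + a) S₂)
  S₁<S₂ = subst (Pointwise _<_ S₁) (drop-drop d a S₂)
    (pointwise-shift⁻ a S₁ (drop d S₂) (subst (Pointwise _<_ (shift a S₁)) (drop-shift b d S₂) columns))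
  |S₂|≡ : length S₂ ≡ d + a + length S₁
  |S₂|≡ = +-cancelˡ-≡ b _ _ (begin
    b + length S₂               ≡⟨ sym (length-shift b S₂) ⟩
    length (shift b S₂)         ≡⟨ lengths ⟩
    b + d + length (shift a S₁) ≡⟨ cong (b + d +_) (length-shift a S₁) ⟩
    b + d + (a + length S₁)     ≡⟨ +-assoc b d _ ⟩
    b + (d + (a + length S₁))   ≡⟨ cong (b +_) (sym (+-assoc d a _)) ⟩
    b + (d + a + length S₁)     ∎)

offset-after-shift : ∀ a b d → a + (b + d ∸ b) ≡ d + a
offset-after-shift a b d = trans (cong (a +_) (m+n∸m≡n b d)) (+-comm a d)

skew-shift-step⁺ : ∀ {h} a b S₁ S₂ → b ≤ h → Skew (a + (h ∸ b)) S₁ S₂ →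
                   Skew h (shift a S₁) (shift b S₂)
skew-shift-step⁺ a b S₁ S₂ b≤h sk with m≤n⇒∃[o]m+o≡n b≤h
... | d , refl = skew-shift⁺ a b d S₁ S₂ (subst (λ i → Skew i S₁ S₂) (offset-after-shift a b d) sk)

skew-shift-step⁻ : ∀ h a b S₁ S₂ → Skew h (shift a S₁) (shift b S₂) →
                   b ≤ h × Skew (a + (h ∸ b)) S₁ S₂
skew-shift-step⁻ h a b S₁ S₂ sk with b ≤? h
... | yes b≤h with m≤n⇒∃[o]m+o≡n b≤h
...   | d , refl =
  b≤h , subst (λ i → Skew i S₁ S₂) (sym (offset-after-shift a b d)) (skew-shift⁻ a b d S₁ S₂ sk)
skew-shift-step⁻ h a b S₁ S₂ (columns , _) | no b≰h with m≤n⇒∃[o]m+o≡n (≰⇒> b≰h)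
... | o , refl =
  ⊥-elim (nothing-below-zero (subst (Pointwise _<_ (shift a S₁)) (drop-shift-overhang h o S₂) columns))
  where
  nothing-below-zero : ∀ {R T} → ¬ Pointwise _<_ R (0 ∷ T)
  nothing-below-zero (() ∷ _)

-- c w = (a , b) says that the letter w occurs a times in the first row and b times in
-- the second; it is read as b down-steps followed by a up-steps of a walk from height h.
Admissible : (ℕ → ℕ × ℕ) → ℕ → ℕ → Set
Admissible c h zero = h ≡ 0
Admissible c h (suc L) = proj₂ (c 0) ≤ h × Admissible (c ∘ suc) (proj₁ (c 0) + (h ∸ proj₂ (c 0))) L

admissible-cong : ∀ c c′ h L → (∀ w → w < L → c w ≡ c′ w) →
                  Admissible c h L → Admissible c′ h L
admissible-cong c c′ h zero _ adm = adm
admissible-cong c c′ h (suc L) c≡c′ (b≤h , adm) with c′ 0 | c≡c′ 0 z<s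
... | _ | refl =
  b≤h , admissible-cong (c ∘ suc) (c′ ∘ suc) _ L (λ w w<L → c≡c′ (suc w) (s≤s w<L)) adm

admissible⇒skew : ∀ c h L → Admissible c h L →
                  Skew h (sortedWord (proj₁ ∘ c) L) (sortedWord (proj₂ ∘ c) L)
admissible⇒skew c h zero refl = [] , refl
admissible⇒skew c h (suc L) (b≤h , adm) =
  skew-shift-step⁺ (proj₁ (c 0)) (proj₂ (c 0)) _ _ b≤h (admissible⇒skew (c ∘ suc) _ L adm)

skew⇒admissible : ∀ L h R₁ R₂ → Sorted R₁ → Sorted R₂ → All (_< L) R₁ → All (_< L) R₂ →
                  Skew h R₁ R₂ → Admissible (λ w → multiplicity w R₁ , multiplicity w R₂) h L
skew⇒admissible zero h [] [] _ _ _ _ (_ , 0≡h+0) = sym (trans 0≡h+0 (+-identityʳ h))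
skew⇒admissible zero h (x ∷ R₁) _ _ _ (() ∷ _) _ _
skew⇒admissible zero h [] (x ∷ R₂) _ _ _ (() ∷ _) _
skew⇒admissible (suc L) h R₁ R₂ s₁ s₂ R₁<L R₂<L sk =
  proj₁ step , admissible-cong _ _ _ L multiplicity-unshift
                 (skew⇒admissible L _ (unshift R₁) (unshift R₂) (sorted-unshift R₁ s₁) (sorted-unshift R₂ s₂)
                    (all-unshift R₁ R₁<L) (all-unshift R₂ R₂<L) (proj₂ step))
  where
  a b : ℕ
  a = multiplicity 0 R₁
  b = multiplicity 0 R₂
  step : b ≤ h × Skew (a + (h ∸ b)) (unshift R₁) (unshift R₂)
  step = skew-shift-step⁻ h a b (unshift R₁) (unshift R₂)
           (subst₂ (Skew h) (sym (shift-unshift R₁ s₁)) (sym (shift-unshift R₂ s₂)) sk)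
  multiplicity-unshift : ∀ w → w < L → (multiplicity w (unshift R₁) , multiplicity w (unshift R₂))
                                      ≡ (multiplicity (suc w) R₁ , multiplicity (suc w) R₂)
  multiplicity-unshift w _ = sym (cong₂ _,_ (multiplicity-suc-unshift w R₁) (multiplicity-suc-unshift w R₂))

total : ℕ × ℕ → ℕ
total c = proj₁ c + proj₂ c

length-sortedWords : ∀ c L → length (sortedWord (proj₁ ∘ c) L) + length (sortedWord (proj₂ ∘ c) L)
                           ≡ sum (applyUpTo (total ∘ c) L)
length-sortedWords c zero = refl
length-sortedWords c (suc L) = begin
  length (shift a R₁) + length (shift b R₂) ≡⟨ cong₂ _+_ (length-shift a R₁) (length-shift b R₂) ⟩
  a + length R₁ + (b + length R₂)           ≡⟨ interchange +-commutativeSemigroup a _ b _ ⟩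
  a + b + (length R₁ + length R₂)           ≡⟨ cong (a + b +_) (length-sortedWords (c ∘ suc) L) ⟩
  a + b + sum (applyUpTo (total ∘ c ∘ suc) L) ∎
  where
  open ≡-Reasoning
  a b : ℕ
  a = proj₁ (c 0)
  b = proj₂ (c 0)
  R₁ R₂ : List ℕ
  R₁ = sortedWord (proj₁ ∘ c ∘ suc) L
  R₂ = sortedWord (proj₂ ∘ c ∘ suc) L

-- Catalan-Riordan paths as content sequences

content₁ : Step₁ → ℕ × ℕ
content₁ up = 1 , 0
content₁ down = 0 , 1

content₂ : Step₂ → ℕ × ℕ
content₂ up2 = 2 , 0
content₂ flat = 1 , 1
content₂ down2 = 0 , 2

stepContent : ∀ {l₁ l₂} → Vec Step₁ l₁ → Vec Step₂ l₂ → ℕ → ℕ × ℕ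
stepContent (s ∷ f) t zero = content₁ s
stepContent (s ∷ f) t (suc w) = stepContent f t w
stepContent [] (s ∷ t) zero = content₂ s
stepContent [] (s ∷ t) (suc w) = stepContent [] t w
stepContent [] [] w = 0 , 0

-- Reading flat as down-then-up is what forbids a flat step on the x-axis.
valid₂⇒admissible : ∀ {l} h (t : Vec Step₂ l) → Valid₂ h t → Admissible (stepContent [] t) h l
valid₂⇒admissible h [] v = v
valid₂⇒admissible h (up2 ∷ t) v = z≤n , valid₂⇒admissible (suc (suc h)) t v
valid₂⇒admissible zero (flat ∷ t) ()
valid₂⇒admissible (suc h) (flat ∷ t) v = s≤s z≤n , valid₂⇒admissible (suc h) t v
valid₂⇒admissible zero (down2 ∷ t) ()
valid₂⇒admissible (suc zero) (down2 ∷ t) ()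
valid₂⇒admissible (suc (suc h)) (down2 ∷ t) v = s≤s (s≤s z≤n) , valid₂⇒admissible h t v

admissible⇒valid₂ : ∀ {l} h (t : Vec Step₂ l) → Admissible (stepContent [] t) h l → Valid₂ h t
admissible⇒valid₂ h [] adm = adm
admissible⇒valid₂ h (up2 ∷ t) (_ , adm) = admissible⇒valid₂ (suc (suc h)) t adm
admissible⇒valid₂ zero (flat ∷ t) (() , _)
admissible⇒valid₂ (suc h) (flat ∷ t) (_ , adm) = admissible⇒valid₂ (suc h) t adm
admissible⇒valid₂ zero (down2 ∷ t) (() , _)
admissible⇒valid₂ (suc zero) (down2 ∷ t) (s≤s () , _)
admissible⇒valid₂ (suc (suc h)) (down2 ∷ t) (_ , adm) = admissible⇒valid₂ h t adm

valid⇒admissible : ∀ {l₁ l₂} h (f : Vec Step₁ l₁) (t : Vec Step₂ l₂) →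
                   Valid h f t → Admissible (stepContent f t) h (l₁ + l₂)
valid⇒admissible h [] t v = valid₂⇒admissible h t v
valid⇒admissible h (up ∷ f) t v = z≤n , valid⇒admissible (suc h) f t v
valid⇒admissible zero (down ∷ f) t ()
valid⇒admissible (suc h) (down ∷ f) t v = s≤s z≤n , valid⇒admissible h f t v

admissible⇒valid : ∀ {l₁ l₂} h (f : Vec Step₁ l₁) (t : Vec Step₂ l₂) →
                   Admissible (stepContent f t) h (l₁ + l₂) → Valid h f t
admissible⇒valid h [] t adm = admissible⇒valid₂ h t adm
admissible⇒valid h (up ∷ f) t (_ , adm) = admissible⇒valid (suc h) f t adm
admissible⇒valid zero (down ∷ f) t (() , _)
admissible⇒valid (suc h) (down ∷ f) t (_ , adm) = admissible⇒valid h f t adm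

typeℕ : ℕ → ℕ → ℕ
typeℕ zero w = 2
typeℕ (suc l) zero = 1
typeℕ (suc l) (suc w) = typeℕ l w

typeℕ-< : ∀ l w → w < l → typeℕ l w ≡ 1
typeℕ-< (suc l) zero _ = refl
typeℕ-< (suc l) (suc w) (s≤s w<l) = typeℕ-< l w w<l

typeℕ-≮ : ∀ l w → ¬ w < l → typeℕ l w ≡ 2
typeℕ-≮ zero w _ = refl
typeℕ-≮ (suc l) zero w≮l = ⊥-elim (w≮l z<s)
typeℕ-≮ (suc l) (suc w) w≮l = typeℕ-≮ l w (w≮l ∘ s≤s)

total-stepContent : ∀ {l₁ l₂} (f : Vec Step₁ l₁) (t : Vec Step₂ l₂) w → w < l₁ + l₂ →
                    total (stepContent f t w) ≡ typeℕ l₁ w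
total-stepContent (up ∷ f) t zero _ = refl
total-stepContent (down ∷ f) t zero _ = refl
total-stepContent (s ∷ f) t (suc w) (s≤s w<l) = total-stepContent f t w w<l
total-stepContent [] (up2 ∷ t) zero _ = refl
total-stepContent [] (flat ∷ t) zero _ = refl
total-stepContent [] (down2 ∷ t) zero _ = refl
total-stepContent [] (s ∷ t) (suc w) (s≤s w<l) = total-stepContent [] t w w<l

sum-totals : ∀ {l₁ l₂} (f : Vec Step₁ l₁) (t : Vec Step₂ l₂) →
             sum (applyUpTo (total ∘ stepContent f t) (l₁ + l₂)) ≡ l₁ + (l₂ + l₂)
sum-totals (s ∷ f) t = cong₂ _+_ (total-stepContent (s ∷ f) t 0 z<s) (sum-totals f t)
sum-totals [] [] = refl
sum-totals {l₂ = suc l} [] (s ∷ t) =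
  trans (cong₂ _+_ (total-stepContent [] (s ∷ t) 0 z<s) (sum-totals [] t)) (cong suc (sym (+-suc l l)))

step₁Of : ℕ → Step₁
step₁Of zero = down
step₁Of (suc _) = up

step₂Of : ℕ → Step₂
step₂Of zero = down2
step₂Of (suc zero) = flat
step₂Of (suc (suc _)) = up2

step₁Of-content₁ : ∀ s → step₁Of (proj₁ (content₁ s)) ≡ s
step₁Of-content₁ up = refl
step₁Of-content₁ down = refl

step₂Of-content₂ : ∀ s → step₂Of (proj₁ (content₂ s)) ≡ s
step₂Of-content₂ up2 = refl
step₂Of-content₂ flat = refl
step₂Of-content₂ down2 = refl

content₁-step₁Of : ∀ a b → a + b ≡ 1 → content₁ (step₁Of a) ≡ (a , b)
content₁-step₁Of zero .1 refl = refl
content₁-step₁Of (suc zero) zero refl = refl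

content₂-step₂Of : ∀ a b → a + b ≡ 2 → content₂ (step₂Of a) ≡ (a , b)
content₂-step₂Of zero .2 refl = refl
content₂-step₂Of (suc zero) (suc zero) refl = refl
content₂-step₂Of (suc (suc zero)) zero refl = refl

stepContent-tabulate₁ : ∀ {l₁ l₂} (g : ℕ → Step₁) (t : Vec Step₂ l₂) w → w < l₁ →
                        stepContent (tabulate {n = l₁} (g ∘ toℕ)) t w ≡ content₁ (g w)
stepContent-tabulate₁ {suc l₁} g t zero _ = refl
stepContent-tabulate₁ {suc l₁} g t (suc w) (s≤s w<l) = stepContent-tabulate₁ (g ∘ suc) t w w<l

stepContent-tabulate₂ : ∀ {l₁ l₂} (f : Vec Step₁ l₁) (g : ℕ → Step₂) j → j < l₂ →
                        stepContent f (tabulate {n = l₂} (g ∘ toℕ)) (l₁ + j) ≡ content₂ (g j)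
stepContent-tabulate₂ (s ∷ f) g j j<l = stepContent-tabulate₂ f g j j<l
stepContent-tabulate₂ {l₂ = suc l₂} [] g zero _ = refl
stepContent-tabulate₂ {l₂ = suc l₂} [] g (suc j) (s≤s j<l) = stepContent-tabulate₂ [] (g ∘ suc) j j<l

stepContent-lookup₁ : ∀ {l₁ l₂} (f : Vec Step₁ l₁) (t : Vec Step₂ l₂) i →
                      stepContent f t (toℕ i) ≡ content₁ (lookup f i)
stepContent-lookup₁ (s ∷ f) t Fin.zero = refl
stepContent-lookup₁ (s ∷ f) t (Fin.suc i) = stepContent-lookup₁ f t i

stepContent-lookup₂ : ∀ {l₁ l₂} (f : Vec Step₁ l₁) (t : Vec Step₂ l₂) j →
                      stepContent f t (l₁ + toℕ j) ≡ content₂ (lookup t j)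
stepContent-lookup₂ (s ∷ f) t j = stepContent-lookup₂ f t j
stepContent-lookup₂ [] (s ∷ t) Fin.zero = refl
stepContent-lookup₂ [] (s ∷ t) (Fin.suc j) = stepContent-lookup₂ [] t j

toℕs : ∀ {m l} → Vec (Fin m) l → List ℕ
toℕs = toList ∘ Vec.map toℕ

toℕs-++ : ∀ {m l₁ l₂} (u : Vec (Fin m) l₁) (v : Vec (Fin m) l₂) →
          toℕs (u ++ᵥ v) ≡ toℕs u ++ toℕs v
toℕs-++ u v = trans (cong toList (map-++ toℕ u v)) (toList-++ (Vec.map toℕ u) (Vec.map toℕ v))

length-toℕs : ∀ {m l} (v : Vec (Fin m) l) → length (toℕs v) ≡ l
length-toℕs v = length-toList (Vec.map toℕ v)

all-toℕs : ∀ {m l} (v : Vec (Fin m) l) → All (_< m) (toℕs v)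
all-toℕs [] = []
all-toℕs (x ∷ v) = toℕ<n x ∷ all-toℕs v

occurrences-toℕs : ∀ {m l} (i : Fin m) (v : Vec (Fin m) l) →
                   occurrences i v ≡ multiplicity (toℕ i) (toℕs v)
occurrences-toℕs i [] = refl
occurrences-toℕs i (x ∷ v) with x ≟ᶠ i | toℕ i ≡ᵇ toℕ x in i≡ᵇx
... | yes _ | true = cong suc (occurrences-toℕs i v)
... | no _ | false = occurrences-toℕs i v
... | yes refl | false = ⊥-elim (subst T i≡ᵇx (≡⇒≡ᵇ (toℕ i) (toℕ i) refl))
... | no x≢i | true =
  ⊥-elim (x≢i (toℕ-injective (sym (≡ᵇ⇒≡ (toℕ i) (toℕ x) (subst T (sym i≡ᵇx) tt)))))

sorted-toℕs : ∀ {m l} (v : Vec (Fin m) l) → WeaklyIncr _≤F_ v → Sorted (toℕs v)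
sorted-toℕs [] _ = tt
sorted-toℕs (x ∷ []) _ = tt
sorted-toℕs (x ∷ y ∷ v) (x≤y , s) = x≤y , sorted-toℕs (y ∷ v) s

weaklyIncr-toℕs : ∀ {m l} (v : Vec (Fin m) l) → Sorted (toℕs v) → WeaklyIncr _≤F_ v
weaklyIncr-toℕs [] _ = tt
weaklyIncr-toℕs (x ∷ []) _ = tt
weaklyIncr-toℕs (x ∷ y ∷ v) (x≤y , s) = x≤y , weaklyIncr-toℕs (y ∷ v) s

pointwise-toℕs⁺ : ∀ {m l} (u v : Vec (Fin m) l) →
                  VecPointwise.Pointwise _<F_ u v → Pointwise _<_ (toℕs u) (toℕs v)
pointwise-toℕs⁺ [] [] [] = []
pointwise-toℕs⁺ (x ∷ u) (y ∷ v) (x<y ∷ u<v) = x<y ∷ pointwise-toℕs⁺ u v u<v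

pointwise-toℕs⁻ : ∀ {m l} (u v : Vec (Fin m) l) →
                  Pointwise _<_ (toℕs u) (toℕs v) → VecPointwise.Pointwise _<F_ u v
pointwise-toℕs⁻ [] [] [] = []
pointwise-toℕs⁻ (x ∷ u) (y ∷ v) (x<y ∷ u<v) = x<y ∷ pointwise-toℕs⁻ u v u<v

fromℕs : ∀ {m l} (xs : List ℕ) → All (_< m) xs → length xs ≡ l → Vec (Fin m) l
fromℕs [] [] refl = []
fromℕs {l = suc l} (x ∷ xs) (x<m ∷ xs<m) |xs|≡ = fromℕ< x<m ∷ fromℕs xs xs<m (suc-injective |xs|≡)

toℕs-fromℕs : ∀ {m l} xs (xs<m : All (_< m) xs) (|xs|≡l : length xs ≡ l) →
              toℕs (fromℕs xs xs<m |xs|≡l) ≡ xs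
toℕs-fromℕs [] [] refl = refl
toℕs-fromℕs {l = suc l} (x ∷ xs) (x<m ∷ xs<m) |xs|≡ =
  cong₂ _∷_ (toℕ-fromℕ< x<m) (toℕs-fromℕs xs xs<m (suc-injective |xs|≡))

toℕs-injective : ∀ {m l} (u v : Vec (Fin m) l) → toℕs u ≡ toℕs v → u ≡ v
toℕs-injective [] [] _ = refl
toℕs-injective (x ∷ u) (y ∷ v) eq =
  let (x≡y , u≡v) = ∷-injective eq in cong₂ _∷_ (toℕ-injective x≡y) (toℕs-injective u v u≡v)

weaklyIncr-irrelevant : ∀ {m l} (v : Vec (Fin m) l) (p q : WeaklyIncr _≤F_ v) → p ≡ q
weaklyIncr-irrelevant [] tt tt = refl
weaklyIncr-irrelevant (x ∷ []) tt tt = refl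
weaklyIncr-irrelevant (x ∷ y ∷ v) (x≤y , p) (x≤y′ , q) =
  cong₂ _,_ (≤-irrelevant x≤y x≤y′) (weaklyIncr-irrelevant (y ∷ v) p q)

vecPointwise-irrelevant : ∀ {A B : Set} {R : A → B → Set} → (∀ {x y} (p q : R x y) → p ≡ q) →
                          ∀ {l} {u : Vec A l} {v : Vec B l} (p q : VecPointwise.Pointwise R u v) → p ≡ q
vecPointwise-irrelevant irr [] [] = refl
vecPointwise-irrelevant irr (p ∷ ps) (q ∷ qs) = cong₂ _∷_ (irr p q) (vecPointwise-irrelevant irr ps qs)

valid₂-irrelevant : ∀ {l} h (t : Vec Step₂ l) (p q : Valid₂ h t) → p ≡ q
valid₂-irrelevant h [] p q = ≡-irrelevant p q
valid₂-irrelevant h (up2 ∷ t) p q = valid₂-irrelevant (suc (suc h)) t p q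
valid₂-irrelevant (suc h) (flat ∷ t) p q = valid₂-irrelevant (suc h) t p q
valid₂-irrelevant (suc (suc h)) (down2 ∷ t) p q = valid₂-irrelevant h t p q

valid-irrelevant : ∀ {l₁ l₂} h (f : Vec Step₁ l₁) (t : Vec Step₂ l₂) (p q : Valid h f t) → p ≡ q
valid-irrelevant h [] t p q = valid₂-irrelevant h t p q
valid-irrelevant h (up ∷ f) t p q = valid-irrelevant (suc h) f t p q
valid-irrelevant (suc h) (down ∷ f) t p q = valid-irrelevant h f t p q

ssyt-≡ : ∀ {n k} (T T′ : SSYT n k) →
         SSYT.row₁ T ≡ SSYT.row₁ T′ → SSYT.row₂ T ≡ SSYT.row₂ T′ → T ≡ T′
ssyt-≡ (ssyt r₁ r₂ s₁ s₂ c o) (ssyt .r₁ .r₂ s₁′ s₂′ c′ o′) refl refl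
  rewrite weaklyIncr-irrelevant r₁ s₁ s₁′ | weaklyIncr-irrelevant r₂ s₂ s₂′
        | vecPointwise-irrelevant ≤-irrelevant c c′ | vecPointwise-irrelevant ≡-irrelevant o o′ = refl

crPath-≡ : ∀ {n k} (P P′ : CRPath n k) →
           CRPath.first P ≡ CRPath.first P′ → CRPath.second P ≡ CRPath.second P′ → P ≡ P′
crPath-≡ (crpath f t v) (crpath .f .t v′) refl refl = cong (crpath f t) (valid-irrelevant 0 f t v v′)

+-double-injective : ∀ x y → x + x ≡ y + y → x ≡ y
+-double-injective zero zero _ = refl
+-double-injective (suc x) (suc y) eq =
  cong suc (+-double-injective x y
    (suc-injective (trans (sym (+-suc x x)) (trans (suc-injective eq) (+-suc y y)))))

module Bijection (n k : ℕ) (k≤n : k ≤ n) where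
  open ≡-Reasoning

  d : ℕ
  d = n ∸ k

  L : ℕ
  L = 2 * k + d

  k+d≡n : k + d ≡ n
  k+d≡n = m+[n∸m]≡n k≤n

  L≡n+k : L ≡ n + k
  L≡n+k = begin
    k + (k + 0) + d ≡⟨ cong (λ z → k + z + d) (+-identityʳ k) ⟩
    k + k + d       ≡⟨ +-assoc k k d ⟩
    k + (k + d)     ≡⟨ cong (k +_) k+d≡n ⟩
    k + n           ≡⟨ +-comm k n ⟩
    n + k           ∎

  2k+2d≡n+n : 2 * k + (d + d) ≡ n + n
  2k+2d≡n+n = begin
    k + (k + 0) + (d + d) ≡⟨ cong (λ z → k + z + (d + d)) (+-identityʳ k) ⟩
    k + k + (d + d)       ≡⟨ interchange +-commutativeSemigroup k k d d ⟩
    k + d + (k + d)       ≡⟨ cong₂ _+_ k+d≡n k+d≡n ⟩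
    n + n                 ∎

  typeμ-typeℕ : ∀ i → typeμ n k i ≡ typeℕ (2 * k) (toℕ i)
  typeμ-typeℕ i with toℕ i <? 2 * k
  ... | yes i<2k = sym (typeℕ-< (2 * k) (toℕ i) i<2k)
  ... | no i≮2k = sym (typeℕ-≮ (2 * k) (toℕ i) i≮2k)

  letter<L : ∀ (i : Fin (n + k)) → toℕ i < L
  letter<L i = subst (toℕ i <_) (sym L≡n+k) (toℕ<n i)

  module FromPath (P : CRPath n k) where
    open CRPath P

    c : ℕ → ℕ × ℕ
    c = stepContent first second

    R₁ R₂ : List ℕ
    R₁ = sortedWord (proj₁ ∘ c) L
    R₂ = sortedWord (proj₂ ∘ c) L

    skew : Skew 0 R₁ R₂
    skew = admissible⇒skew c 0 L (valid⇒admissible 0 first second valid)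

    |R₁|≡n : length R₁ ≡ n
    |R₁|≡n = +-double-injective (length R₁) n (begin
      length R₁ + length R₁ ≡⟨ cong (length R₁ +_) (sym (proj₂ skew)) ⟩
      length R₁ + length R₂ ≡⟨ length-sortedWords c L ⟩
      sum (applyUpTo (total ∘ c) L) ≡⟨ sum-totals first second ⟩
      2 * k + (d + d)       ≡⟨ 2k+2d≡n+n ⟩
      n + n                 ∎)

    bounded : ∀ a → All (_< n + k) (sortedWord a L)
    bounded a = subst (λ m → All (_< m) (sortedWord a L)) L≡n+k (all-sortedWord a L)

    r₁ r₂ : Vec (Fin (n + k)) n
    r₁ = fromℕs R₁ (bounded _) |R₁|≡n
    r₂ = fromℕs R₂ (bounded _) (trans (proj₂ skew) |R₁|≡n)

    toℕs-r₁ : toℕs r₁ ≡ R₁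
    toℕs-r₁ = toℕs-fromℕs R₁ _ _

    toℕs-r₂ : toℕs r₂ ≡ R₂
    toℕs-r₂ = toℕs-fromℕs R₂ _ _

    multiplicity-r₁ : ∀ w → w < L → multiplicity w (toℕs r₁) ≡ proj₁ (c w)
    multiplicity-r₁ w w<L = trans (cong (multiplicity w) toℕs-r₁) (multiplicity-sortedWord _ L w w<L)

    multiplicity-r₂ : ∀ w → w < L → multiplicity w (toℕs r₂) ≡ proj₂ (c w)
    multiplicity-r₂ w w<L = trans (cong (multiplicity w) toℕs-r₂) (multiplicity-sortedWord _ L w w<L)

    occurrences-r₁++r₂ : ∀ i → occurrences i (r₁ ++ᵥ r₂) ≡ typeμ n k i
    occurrences-r₁++r₂ i = begin
      occurrences i (r₁ ++ᵥ r₂)              ≡⟨ occurrences-toℕs i (r₁ ++ᵥ r₂) ⟩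
      multiplicity w (toℕs (r₁ ++ᵥ r₂))      ≡⟨ cong (multiplicity w) (toℕs-++ r₁ r₂) ⟩
      multiplicity w (toℕs r₁ ++ toℕs r₂)    ≡⟨ multiplicity-++ w (toℕs r₁) (toℕs r₂) ⟩
      multiplicity w (toℕs r₁) + multiplicity w (toℕs r₂)
        ≡⟨ cong₂ _+_ (multiplicity-r₁ w (letter<L i)) (multiplicity-r₂ w (letter<L i)) ⟩
      total (c w)                            ≡⟨ total-stepContent first second w (letter<L i) ⟩
      typeℕ (2 * k) w                        ≡⟨ sym (typeμ-typeℕ i) ⟩
      typeμ n k i                            ∎
      where
      w : ℕ
      w = toℕ i

    tableau : SSYT n k
    tableau = ssyt r₁ r₂
      (weaklyIncr-toℕs r₁ (subst Sorted (sym toℕs-r₁) (sorted-sortedWord _ L)))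
      (weaklyIncr-toℕs r₂ (subst Sorted (sym toℕs-r₂) (sorted-sortedWord _ L)))
      (pointwise-toℕs⁻ r₁ r₂ (subst₂ (Pointwise _<_) (sym toℕs-r₁) (sym toℕs-r₂) (proj₁ skew)))
      (VecPointwise.tabulate⁺ occurrences-r₁++r₂)

  module FromTableau (T : SSYT n k) where
    open SSYT T

    R₁ R₂ : List ℕ
    R₁ = toℕs row₁
    R₂ = toℕs row₂

    occurrences-rows : ∀ i → occurrences i (row₁ ++ᵥ row₂) ≡ typeμ n k i
    occurrences-rows i = subst₂ (λ j m → occurrences j (row₁ ++ᵥ row₂) ≡ m)
      (lookup-allFin i) (lookup∘tabulate (typeμ n k) i) (VecPointwise.lookup content i)

    totals-letter : ∀ i →
                    multiplicity (toℕ i) R₁ + multiplicity (toℕ i) R₂ ≡ typeℕ (2 * k) (toℕ i)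
    totals-letter i = begin
      multiplicity w R₁ + multiplicity w R₂ ≡⟨ sym (multiplicity-++ w R₁ R₂) ⟩
      multiplicity w (R₁ ++ R₂)             ≡⟨ cong (multiplicity w) (sym (toℕs-++ row₁ row₂)) ⟩
      multiplicity w (toℕs (row₁ ++ᵥ row₂)) ≡⟨ sym (occurrences-toℕs i (row₁ ++ᵥ row₂)) ⟩
      occurrences i (row₁ ++ᵥ row₂)         ≡⟨ occurrences-rows i ⟩
      typeμ n k i                           ≡⟨ typeμ-typeℕ i ⟩
      typeℕ (2 * k) w                       ∎
      where
      w : ℕ
      w = toℕ i

    totals : ∀ w → w < L → multiplicity w R₁ + multiplicity w R₂ ≡ typeℕ (2 * k) w
    totals w w<L = subst (λ v → multiplicity v R₁ + multiplicity v R₂ ≡ typeℕ (2 * k) v)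
      (toℕ-fromℕ< w<n+k) (totals-letter (fromℕ< w<n+k))
      where
      w<n+k : w < n + k
      w<n+k = subst (w <_) L≡n+k w<L

    path₁ : Vec Step₁ (2 * k)
    path₁ = tabulate ((λ w → step₁Of (multiplicity w R₁)) ∘ toℕ)

    path₂ : Vec Step₂ d
    path₂ = tabulate ((λ j → step₂Of (multiplicity (2 * k + j) R₁)) ∘ toℕ)

    stepContent-path : ∀ w → w < L →
                       stepContent path₁ path₂ w ≡ (multiplicity w R₁ , multiplicity w R₂)
    stepContent-path w w<L with w <? 2 * k
    ... | yes w<2k = trans (stepContent-tabulate₁ _ path₂ w w<2k)
          (content₁-step₁Of _ _ (trans (totals w w<L) (typeℕ-< (2 * k) w w<2k)))
    ... | no w≮2k with m≤n⇒∃[o]m+o≡n (≮⇒≥ w≮2k)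
    ...   | j , refl = trans (stepContent-tabulate₂ path₁ _ j (+-cancelˡ-< (2 * k) j d w<L))
          (content₂-step₂Of _ _ (trans (totals w w<L) (typeℕ-≮ (2 * k) w w≮2k)))

    sorted₁ : Sorted R₁
    sorted₁ = sorted-toℕs row₁ rows₁

    sorted₂ : Sorted R₂
    sorted₂ = sorted-toℕs row₂ rows₂

    bounded₁ : All (_< L) R₁
    bounded₁ = subst (λ m → All (_< m) R₁) (sym L≡n+k) (all-toℕs row₁)

    bounded₂ : All (_< L) R₂
    bounded₂ = subst (λ m → All (_< m) R₂) (sym L≡n+k) (all-toℕs row₂)

    path : CRPath n k
    path = crpath path₁ path₂ (admissible⇒valid 0 path₁ path₂
      (admissible-cong _ _ 0 L (λ w w<L → sym (stepContent-path w w<L))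
        (skew⇒admissible L 0 R₁ R₂ sorted₁ sorted₂ bounded₁ bounded₂
          (pointwise-toℕs⁺ row₁ row₂ cols , trans (length-toℕs row₂) (sym (length-toℕs row₁))))))

  toTableau : CRPath n k → SSYT n k
  toTableau = FromPath.tableau

  toPath : SSYT n k → CRPath n k
  toPath = FromTableau.path

  toTableau-toPath : ∀ T → toTableau (toPath T) ≡ T
  toTableau-toPath T = ssyt-≡ _ T
    (toℕs-injective _ _ (trans (FromPath.toℕs-r₁ (toPath T))
      (sortedWord-content _ L R₁ sorted₁ bounded₁ (λ w w<L → cong proj₁ (stepContent-path w w<L)))))
    (toℕs-injective _ _ (trans (FromPath.toℕs-r₂ (toPath T))
      (sortedWord-content _ L R₂ sorted₂ bounded₂ (λ w w<L → cong proj₂ (stepContent-path w w<L)))))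
    where open FromTableau T

  toPath-toTableau : ∀ P → toPath (toTableau P) ≡ P
  toPath-toTableau P = crPath-≡ _ P
    (trans (tabulate-cong λ i → trans
        (cong step₁Of (trans (multiplicity-r₁ (toℕ i) (<-≤-trans (toℕ<n i) (m≤m+n (2 * k) d)))
                             (cong proj₁ (stepContent-lookup₁ first second i))))
        (step₁Of-content₁ (lookup first i)))
      (tabulate∘lookup first))
    (trans (tabulate-cong λ j → trans
        (cong step₂Of (trans (multiplicity-r₁ (2 * k + toℕ j) (+-monoʳ-< (2 * k) (toℕ<n j)))
                             (cong proj₁ (stepContent-lookup₂ first second j))))
        (step₂Of-content₂ (lookup second j)))
      (tabulate∘lookup second))
    where
    open CRPath P
    open FromPath P using (multiplicity-r₁)

theorem3p3 : (n k : ℕ) → k ≤ n → CRPath n k ⤖ SSYT n k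
theorem3p3 n k k≤n = ↔⇒⤖ (mk↔ₛ′ toTableau toPath toTableau-toPath toPath-toTableau)
  where open Bijection n k k≤n
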